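{- Let $f(n)=an^{2}+bn+c$ with $a,b,c\in\mathbb{Z}$, $a$ odd, $b$ even, and $b^{2}-4ac=0$. Then the 2-adic valuation tree of $f$ has one infinite branch.
   Context: $\nu_2(x)$ denotes the 2-adic valuation of an integer $x$ (with $\nu_2(0)=+\infty$), $\mathbb{N}=\{0,1,2,\ldots\}$. The 2-adic valuation tree of $f$: a node at level $i\geq 0$ is a residue class $\{2^{i}q+r: q\in\mathbb{N}\}$ with $0\le r<2^i$; the root (level 0) is all of $\mathbb{N}$. A node is terminating if $\nu_2(f(n))$ is constant on its class, and non-terminating otherwise. Each non-terminating node $\{2^iq+r\}$ has two children at level $i+1$, namely $\{2^{i+1}q+r\}$ and $\{2^{i+1}q+2^i+r\}$; terminating nodes have no children. An infinite branch is an infinite sequence of nodes, one at each level $i\geq 0$, each a child of the previous one. -}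

module Defs where

open import Data.Nat as ℕ using (ℕ; zero; suc; _^_; _<_)
open import Data.Nat.DivMod using (_/_; _%_)
open import Data.Integer as ℤ using (ℤ; +_; ∣_∣)
open import Data.Maybe using (Maybe; just; nothing)
open import Data.Product using (Σ; _×_)
open import Data.Sum using (_⊎_)
open import Relation.Nullary using (¬_)
open import Relation.Binary.PropositionalEquality using (_≡_)

-- ℕ∞ : a natural number or +∞ (nothing = +∞)
ℕ∞ : Set
ℕ∞ = Maybe ℕ

-- valFuel k n : number of times 2 divides n, computed with k steps of fuel
-- (correct whenever k ≥ ν₂(n), e.g. k = n for n > 0)
valFuel : ℕ → ℕ → ℕ
valFuel zero    n = 0
valFuel (suc k) zero = 0
valFuel (suc k) (suc m) with suc m % 2
... | zero  = suc (valFuel k (suc m / 2))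
... | suc _ = 0

ν₂ : ℤ → ℕ∞
ν₂ x with ∣ x ∣
... | zero  = nothing
... | suc m = just (valFuel (suc m) (suc m))

quad : ℤ → ℤ → ℤ → ℕ → ℤ
quad a b c n = a ℤ.* (+ n) ℤ.* (+ n) ℤ.+ b ℤ.* (+ n) ℤ.+ c

Terminating : (ℕ → ℤ) → ℕ → ℕ → Set
Terminating f i r = ∀ q q' → ν₂ (f (2 ^ i ℕ.* q ℕ.+ r)) ≡ ν₂ (f (2 ^ i ℕ.* q' ℕ.+ r))

NonTerminating : (ℕ → ℤ) → ℕ → ℕ → Set
NonTerminating f i r = ¬ Terminating f i r

-- An infinite branch of the 2-adic valuation tree of f: node at level i is
-- the class of residue (r i) mod 2^i; each node is a child of the previous one,
-- which therefore must be non-terminating (have children).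
IsInfiniteBranch : (ℕ → ℤ) → (ℕ → ℕ) → Set
IsInfiniteBranch f r =
  (∀ i → r i < 2 ^ i) ×
  (∀ i → (r (suc i) ≡ r i ⊎ r (suc i) ≡ 2 ^ i ℕ.+ r i)) ×
  (∀ i → NonTerminating f i (r i))

HasUniqueInfiniteBranch : (ℕ → ℤ) → Set
HasUniqueInfiniteBranch f =
  Σ (ℕ → ℕ) (λ r → IsInfiniteBranch f r) ×
  (∀ r r' → IsInfiniteBranch f r → IsInfiniteBranch f r' → ∀ i → r i ≡ r' i)

{-# OPTIONS --safe #-}
-- Write b = 2b′.  The vanishing discriminant gives b′² = ac, hence a·f(n) = (an + b′)², and since a
-- is odd, ν₂(f(n)) = 2·ν₂(an + b′).  On the class {2^i q + r} the linear form an + b′ moves by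
-- multiples of a·2^i, so the node is terminating exactly when 2^i ∤ ar + b′.  The two children r
-- and 2^i + r of a non-terminating node have values differing by a·2^i, which is divisible by 2^i
-- but not 2^(i+1); so exactly one child is again non-terminating, and the non-terminating nodes
-- form a single infinite branch.
module Submission where

open import Data.Empty using (⊥-elim)
open import Data.Integer.Base using (ℤ; +_; 0ℤ; -_; _+_; _-_; _*_; NonZero; _%ℕ_; _/ℕ_)
open import Data.Integer.DivMod using (a≡a%ℕn+[a/ℕn]*n; n%ℕd<d)
open import Data.Integer.Divisibility using () renaming (_∣_ to _∣ᵤ_)
open import Data.Integer.Divisibility.Signed
import Data.Integer.Base as ℤ
import Data.Integer.Properties as ℤ
open import Data.Integer.Tactic.RingSolver using (solve-∀)
open import Data.Maybe.Base using (just)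
open import Data.Nat.Base as ℕ using (ℕ; zero; suc; _^_; _%_; _/_; _≤_; _<_; z≤n; s≤s)
import Data.Nat.DivMod as ℕ
import Data.Nat.Divisibility as ℕ
import Data.Nat.Properties as ℕ
open import Data.Product.Base using (∃-syntax; _×_; _,_; proj₁; proj₂)
open import Data.Sum.Base using (_⊎_; inj₁; inj₂)
open import Defs
open import Relation.Binary.PropositionalEquality
open import Relation.Nullary using (¬_; yes; no)
open import Relation.Nullary.Decidable using (decidable-stable)

-- Opaque so that exponents can be inferred by unification from 2^ v, which fails for + (2 ^ v).
opaque
  2^_ : ℕ → ℤ
  2^ v = + (2 ^ v)

opaque
  unfolding 2^_

  2^-pos : ∀ v → 2^ v ≡ + (2 ^ v)
  2^-pos v = refl

  2^-zero : 2^ 0 ≡ + 1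
  2^-zero = refl

  2^-suc : ∀ v → 2^ suc v ≡ + 2 * 2^ v
  2^-suc v = ℤ.pos-* 2 (2 ^ v)

  2^-+ : ∀ v w → 2^ (v ℕ.+ w) ≡ 2^ v * 2^ w
  2^-+ v w = trans (cong +_ (ℕ.^-distribˡ-+-* 2 v w)) (ℤ.pos-* (2 ^ v) (2 ^ w))

  2^-nonZero : ∀ v → NonZero (2^ v)
  2^-nonZero v = ℕ.m^n≢0 2 v

2^-mono-∣ : ∀ {v w} → v ≤ w → 2^ v ∣ 2^ w
2^-mono-∣ {w = w} z≤n =
  divides (2^ w) (trans (sym (ℤ.*-identityʳ (2^ w))) (cong (2^ w *_) (sym 2^-zero)))
2^-mono-∣ {suc v} {suc w} (s≤s v≤w) =
  subst₂ _∣_ (sym (2^-suc v)) (sym (2^-suc w)) (*-monoʳ-∣ (+ 2) (2^-mono-∣ v≤w))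

Odd : ℤ → Set
Odd k = ¬ + 2 ∣ k

odd-1+*2 : ∀ t → Odd (+ 1 + t * + 2)
odd-1+*2 t 2∣1+2t with () ← ℕ.∣1⇒≡1 (∣⇒∣ᵤ (∣m+n∣n⇒∣m {m = + 1} 2∣1+2t (divides t refl)))

odd⇒1+*2 : ∀ {k} → Odd k → ∃[ t ] k ≡ + 1 + t * + 2
odd⇒1+*2 {k} k-odd with k %ℕ 2 | a≡a%ℕn+[a/ℕn]*n k 2 | n%ℕd<d k 2
... | 0 | k≡ | _ = ⊥-elim (k-odd (divides (k /ℕ 2) (trans k≡ (ℤ.+-identityˡ _))))
... | 1 | k≡ | _ = k /ℕ 2 , k≡
... | suc (suc _) | _ | s≤s (s≤s ())

odd-* : ∀ {k l} → Odd k → Odd l → Odd (k * l)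
odd-* k-odd l-odd with odd⇒1+*2 k-odd | odd⇒1+*2 l-odd
... | s , refl | t , refl = subst Odd (sym (expand s t)) (odd-1+*2 (s + t + s * t * + 2))
  where
  expand : ∀ s t → (+ 1 + s * + 2) * (+ 1 + t * + 2) ≡ + 1 + (s + t + s * t * + 2) * + 2
  expand = solve-∀

odd+odd⇒even : ∀ {k l} → Odd k → Odd l → + 2 ∣ k + l
odd+odd⇒even k-odd l-odd with odd⇒1+*2 k-odd | odd⇒1+*2 l-odd
... | s , refl | t , refl = divides (+ 1 + s + t) (expand s t)
  where
  expand : ∀ s t → (+ 1 + s * + 2) + (+ 1 + t * + 2) ≡ (+ 1 + s + t) * + 2
  expand = solve-∀

infix 4 2^_∥_

record 2^_∥_ (v : ℕ) (x : ℤ) : Set where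
  constructor exact
  field
    2^∣ : 2^ v ∣ x
    2^suc∤ : ¬ 2^ suc v ∣ x
open 2^_∥_

odd⇒2^0∥ : ∀ {k} → Odd k → 2^ 0 ∥ k
odd⇒2^0∥ {k} k-odd =
  exact (subst (_∣ k) (sym 2^-zero) (divides k (sym (ℤ.*-identityʳ k))))
        (λ 2^1∣k → k-odd (subst (_∣ k) (trans (2^-suc 0) (cong (+ 2 *_) 2^-zero)) 2^1∣k))

∥⇒≢0 : ∀ {v x} → 2^ v ∥ x → x ≢ 0ℤ
∥⇒≢0 (exact _ ¬2^sv∣x) refl = ¬2^sv∣x (divides 0ℤ refl)

∥⇒odd-cofactor : ∀ {v x} → 2^ v ∥ x → ∃[ k ] Odd k × x ≡ k * 2^ v
∥⇒odd-cofactor {v} (exact (divides k x≡k*2^v) ¬2^sv∣x) = k , k-odd , x≡k*2^v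
  where
  k-odd : Odd k
  k-odd 2∣k = ¬2^sv∣x (subst₂ _∣_ (sym (2^-suc v)) (sym x≡k*2^v) (*-monoˡ-∣ (2^ v) 2∣k))

odd*2^∥ : ∀ {k} v → Odd k → 2^ v ∥ k * 2^ v
odd*2^∥ {k} v k-odd =
  exact (divides k refl) λ 2^sv∣ →
    k-odd (*-cancelʳ-∣ (2^ v) {{2^-nonZero v}} (subst (_∣ k * 2^ v) (2^-suc v) 2^sv∣))

∥-* : ∀ {v w x y} → 2^ v ∥ x → 2^ w ∥ y → 2^ (v ℕ.+ w) ∥ x * y
∥-* {v} {w} {x} {y} x∥ y∥ with ∥⇒odd-cofactor x∥ | ∥⇒odd-cofactor y∥
... | k , k-odd , x≡ | l , l-odd , y≡ =
  subst (2^ (v ℕ.+ w) ∥_) (sym regroup) (odd*2^∥ (v ℕ.+ w) (odd-* k-odd l-odd))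
  where
  open ≡-Reasoning
  interchange : ∀ k s l t → (k * s) * (l * t) ≡ (k * l) * (s * t)
  interchange = solve-∀
  regroup : x * y ≡ k * l * 2^ (v ℕ.+ w)
  regroup = begin
    x * y                   ≡⟨ cong₂ _*_ x≡ y≡ ⟩
    k * 2^ v * (l * 2^ w)   ≡⟨ interchange k (2^ v) l (2^ w) ⟩
    k * l * (2^ v * 2^ w)   ≡⟨ cong (k * l *_) (2^-+ v w) ⟨
    k * l * 2^ (v ℕ.+ w)    ∎

∣⇒square-∣ : ∀ {v x} → 2^ v ∣ x → 2^ (v ℕ.+ v) ∣ x * x
∣⇒square-∣ {v} (divides k refl) = divides (k * k) (begin
    k * 2^ v * (k * 2^ v)   ≡⟨ interchange k (2^ v) ⟩
    k * k * (2^ v * 2^ v)   ≡⟨ cong (k * k *_) (2^-+ v v) ⟨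
    k * k * 2^ (v ℕ.+ v)    ∎)
  where
  open ≡-Reasoning
  interchange : ∀ k s → (k * s) * (k * s) ≡ (k * k) * (s * s)
  interchange = solve-∀

∥+∣⇒∥ : ∀ {v x z} → 2^ v ∥ x → 2^ suc v ∣ z → 2^ v ∥ x + z
∥+∣⇒∥ {v} (exact 2^v∣x ¬2^sv∣x) 2^sv∣z =
  exact (∣m∣n⇒∣m+n 2^v∣x (∣-trans (2^-mono-∣ (ℕ.n≤1+n v)) 2^sv∣z))
        λ 2^sv∣x+z → ¬2^sv∣x (∣m+n∣n⇒∣m 2^sv∣x+z 2^sv∣z)

∥+∥⇒∣ : ∀ {v x z} → 2^ v ∥ x → 2^ v ∥ z → 2^ suc v ∣ x + z
∥+∥⇒∣ {v} {x} {z} x∥ z∥ with ∥⇒odd-cofactor x∥ | ∥⇒odd-cofactor z∥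
... | k , k-odd , x≡ | l , l-odd , z≡ with odd+odd⇒even k-odd l-odd
... | divides m k+l≡m*2 = divides m (begin
    x + z                 ≡⟨ cong₂ _+_ x≡ z≡ ⟩
    k * 2^ v + l * 2^ v   ≡⟨ ℤ.*-distribʳ-+ (2^ v) k l ⟨
    (k + l) * 2^ v        ≡⟨ cong (_* 2^ v) k+l≡m*2 ⟩
    m * + 2 * 2^ v        ≡⟨ ℤ.*-assoc m (+ 2) (2^ v) ⟩
    m * (+ 2 * 2^ v)      ≡⟨ cong (m *_) (2^-suc v) ⟨
    m * 2^ suc v          ∎)
  where open ≡-Reasoning

∣∧∤⇒≤ : ∀ {v w x} → 2^ v ∣ x → ¬ 2^ suc w ∣ x → v ≤ w
∣∧∤⇒≤ {v} {w} 2^v∣x 2^sw∤x with v ℕ.≤? w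
... | yes v≤w = v≤w
... | no v≰w = ⊥-elim (2^sw∤x (∣-trans (2^-mono-∣ (ℕ.≰⇒> v≰w)) 2^v∣x))

∥-unique : ∀ {v w x} → 2^ v ∥ x → 2^ w ∥ x → v ≡ w
∥-unique (exact 2^v∣x 2^sv∤x) (exact 2^w∣x 2^sw∤x) =
  ℕ.≤-antisym (∣∧∤⇒≤ 2^v∣x 2^sw∤x) (∣∧∤⇒≤ 2^w∣x 2^sv∤x)

valFuel-exact : ∀ {k} m → suc m ≤ k →
  2 ^ valFuel k (suc m) ℕ.∣ suc m × ¬ 2 ^ suc (valFuel k (suc m)) ℕ.∣ suc m
valFuel-exact {suc k} m (s≤s m<k) with suc m % 2 in rem≡
... | suc _ = ℕ.1∣ suc m , λ 2∣ → ℕ.0≢1+n (trans (sym (ℕ.n∣m⇒m%n≡0 (suc m) 2 2∣)) rem≡)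
... | zero =
  halve (suc m / 2) (trans (ℕ.m≡m%n+[m/n]*n (suc m) 2) (cong (ℕ._+ suc m / 2 ℕ.* 2) rem≡))
  where
  halve : ∀ h → suc m ≡ h ℕ.* 2 →
    2 ^ suc (valFuel k h) ℕ.∣ suc m × ¬ 2 ^ suc (suc (valFuel k h)) ℕ.∣ suc m
  halve (suc h) m≡ = subst (2 ^ suc v ℕ.∣_) (sym m≡′) (ℕ.*-monoʳ-∣ 2 2^v∣) ,
                     λ 2^ssv∣ → 2^sv∤ (ℕ.*-cancelˡ-∣ 2 (subst (2 ^ suc (suc v) ℕ.∣_) m≡′ 2^ssv∣))
    where
    h<k : suc h ≤ k
    h<k = ℕ.≤-trans (s≤s (ℕ.m≤m*n h 2)) (subst (_≤ k) (cong ℕ.pred m≡) m<k)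
    v = valFuel k (suc h)
    m≡′ : suc m ≡ 2 ℕ.* suc h
    m≡′ = trans m≡ (ℕ.*-comm (suc h) 2)
    2^v∣ = proj₁ (valFuel-exact h h<k)
    2^sv∤ = proj₂ (valFuel-exact h h<k)

ν₂-spec : ∀ x → x ≡ 0ℤ ⊎ ∃[ v ] ν₂ x ≡ just v × 2^ v ∥ x
ν₂-spec x with ℤ.∣ x ∣ in ∣x∣≡
... | zero = inj₁ (ℤ.∣i∣≡0⇒i≡0 ∣x∣≡)
... | suc m = inj₂ (v , refl , exact
        (subst (_∣ x) (sym (2^-pos v)) (∣ᵤ⇒∣ (subst (2 ^ v ℕ.∣_) (sym ∣x∣≡) 2^v∣)))
        λ 2^sv∣x →
          2^sv∤ (subst (2 ^ suc v ℕ.∣_) ∣x∣≡ (∣⇒∣ᵤ (subst (_∣ x) (2^-pos (suc v)) 2^sv∣x))))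
  where
  v = valFuel (suc m) (suc m)
  2^v∣ = proj₁ (valFuel-exact m ℕ.≤-refl)
  2^sv∤ = proj₂ (valFuel-exact m ℕ.≤-refl)

∥⇒ν₂≡just : ∀ {v x} → 2^ v ∥ x → ν₂ x ≡ just v
∥⇒ν₂≡just {x = x} x∥ with ν₂-spec x
... | inj₁ x≡0 = ⊥-elim (∥⇒≢0 x∥ x≡0)
... | inj₂ (w , ν₂x≡w , x∥′) = trans ν₂x≡w (cong just (∥-unique x∥′ x∥))

ν₂≡just⇒∥ : ∀ {v x} → ν₂ x ≡ just v → 2^ v ∥ x
ν₂≡just⇒∥ {x = x} ν₂x≡v with ν₂-spec x
... | inj₁ refl with () ← ν₂x≡v
... | inj₂ (w , ν₂x≡w , x∥) with trans (sym ν₂x≡w) ν₂x≡v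
... | refl = x∥

∥-cancel-odd : ∀ {v a x} → Odd a → 2^ v ∥ a * x → 2^ v ∥ x
∥-cancel-odd {a = a} {x} a-odd ax∥ with ν₂-spec x
... | inj₁ refl = ⊥-elim (∥⇒≢0 ax∥ (ℤ.*-zeroʳ a))
... | inj₂ (w , _ , x∥) with ∥-unique ax∥ (∥-* (odd⇒2^0∥ a-odd) x∥)
... | refl = x∥

Terminating⇒ν₂-sibling : ∀ {f i r} → Terminating f i r → ν₂ (f r) ≡ ν₂ (f (2 ^ i ℕ.+ r))
Terminating⇒ν₂-sibling {f} {i} {r} term =
  subst₂ (λ n n′ → ν₂ (f n) ≡ ν₂ (f n′))
    (cong (ℕ._+ r) (ℕ.*-zeroʳ (2 ^ i))) (cong (ℕ._+ r) (ℕ.*-identityʳ (2 ^ i)))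
    (term 0 1)

module _ (a b′ : ℤ) (f : ℕ → ℤ) (a-odd : Odd a)
         (a*f≡ℓ² : ∀ n → a * f n ≡ (a * + n + b′) * (a * + n + b′)) where

  ℓ : ℕ → ℤ
  ℓ n = a * + n + b′

  ℓ-shift : ∀ i q r → ℓ (2 ^ i ℕ.* q ℕ.+ r) ≡ ℓ r + a * 2^ i * + q
  ℓ-shift i q r = begin
      a * + (2 ^ i ℕ.* q ℕ.+ r) + b′   ≡⟨ cong (λ n → a * n + b′) (ℤ.pos-+ (2 ^ i ℕ.* q) r) ⟩
      a * (+ (2 ^ i ℕ.* q) + + r) + b′ ≡⟨ cong (λ n → a * (n + + r) + b′) (ℤ.pos-* (2 ^ i) q) ⟩
      a * (+ (2 ^ i) * + q + + r) + b′ ≡⟨ cong (λ n → a * (n * + q + + r) + b′) (2^-pos i) ⟨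
      a * (2^ i * + q + + r) + b′      ≡⟨ regroup a (2^ i) (+ q) (+ r) b′ ⟩
      ℓ r + a * 2^ i * + q             ∎
    where
    open ≡-Reasoning
    regroup : ∀ a s q r b′ → a * (s * q + r) + b′ ≡ a * r + b′ + a * s * q
    regroup = solve-∀

  ℓ-sibling : ∀ i r → ℓ (2 ^ i ℕ.+ r) ≡ a * 2^ i + ℓ r
  ℓ-sibling i r = begin
      a * + (2 ^ i ℕ.+ r) + b′   ≡⟨ cong (λ n → a * n + b′) (ℤ.pos-+ (2 ^ i) r) ⟩
      a * (+ (2 ^ i) + + r) + b′ ≡⟨ cong (λ n → a * (n + + r) + b′) (2^-pos i) ⟨
      a * (2^ i + + r) + b′      ≡⟨ regroup a (2^ i) (+ r) b′ ⟩
      a * 2^ i + ℓ r             ∎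
    where
    open ≡-Reasoning
    regroup : ∀ a s r b′ → a * (s + r) + b′ ≡ a * s + (a * r + b′)
    regroup = solve-∀

  ν₂-f-∥ : ∀ {v n} → 2^ v ∥ ℓ n → ν₂ (f n) ≡ just (v ℕ.+ v)
  ν₂-f-∥ {v} {n} ℓn∥ =
    ∥⇒ν₂≡just (∥-cancel-odd a-odd (subst (2^ (v ℕ.+ v) ∥_) (sym (a*f≡ℓ² n)) (∥-* ℓn∥ ℓn∥)))

  ν₂-f-∣ : ∀ {v n} → 2^ suc v ∣ ℓ n → ν₂ (f n) ≢ just (v ℕ.+ v)
  ν₂-f-∣ {v} {n} 2^sv∣ℓn ν₂fn≡ =
    2^suc∤ (∥-* (odd⇒2^0∥ a-odd) (ν₂≡just⇒∥ ν₂fn≡))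
      (subst (2^ suc (v ℕ.+ v) ∣_) (sym (a*f≡ℓ² n))
        (∣-trans (2^-mono-∣ (s≤s (ℕ.+-monoʳ-≤ v (ℕ.n≤1+n v)))) (∣⇒square-∣ 2^sv∣ℓn)))

  sibling-∣ : ∀ i r → 2^ i ∣ ℓ r → ¬ 2^ suc i ∣ ℓ r → 2^ suc i ∣ ℓ (2 ^ i ℕ.+ r)
  sibling-∣ i r 2^i∣ℓr 2^si∤ℓr =
    subst (2^ suc i ∣_) (sym (ℓ-sibling i r)) (∥+∥⇒∣ (odd*2^∥ i a-odd) (exact 2^i∣ℓr 2^si∤ℓr))

  sibling-∥ : ∀ i r → 2^ suc i ∣ ℓ r → 2^ i ∥ ℓ (2 ^ i ℕ.+ r)
  sibling-∥ i r 2^si∣ℓr =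
    subst (2^ i ∥_) (sym (ℓ-sibling i r)) (∥+∣⇒∥ (odd*2^∥ i a-odd) 2^si∣ℓr)

  terminating : ∀ i r → ¬ 2^ i ∣ ℓ r → Terminating f i r
  terminating i r 2^i∤ℓr with ν₂-spec (ℓ r)
  ... | inj₁ ℓr≡0 = ⊥-elim (2^i∤ℓr (subst (2^ i ∣_) (sym ℓr≡0) (divides 0ℤ refl)))
  ... | inj₂ (j , _ , ℓr∥) = λ q q′ → trans (ν₂-class q) (sym (ν₂-class q′))
    where
    j<i : j < i
    j<i = ℕ.≰⇒> (λ i≤j → 2^i∤ℓr (∣-trans (2^-mono-∣ i≤j) (2^∣ ℓr∥)))
    ν₂-class : ∀ q → ν₂ (f (2 ^ i ℕ.* q ℕ.+ r)) ≡ just (j ℕ.+ j)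
    ν₂-class q = ν₂-f-∥ (subst (2^ j ∥_) (sym (ℓ-shift i q r))
                   (∥+∣⇒∥ ℓr∥ (∣m⇒∣m*n (+ q) (∣n⇒∣m*n a (2^-mono-∣ j<i)))))

  nonTerminating : ∀ i r → 2^ i ∣ ℓ r → NonTerminating f i r
  nonTerminating i r 2^i∣ℓr term with Terminating⇒ν₂-sibling {f} {i} term | 2^ suc i ∣? ℓ r
  ... | ν₂-siblings | yes 2^si∣ℓr =
    ν₂-f-∣ 2^si∣ℓr (trans ν₂-siblings (ν₂-f-∥ (sibling-∥ i r 2^si∣ℓr)))
  ... | ν₂-siblings | no 2^si∤ℓr =
    ν₂-f-∣ (sibling-∣ i r 2^i∣ℓr 2^si∤ℓr) (trans (sym ν₂-siblings) (ν₂-f-∥ (exact 2^i∣ℓr 2^si∤ℓr)))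

  nonTerminating⇒∣ : ∀ i r → NonTerminating f i r → 2^ i ∣ ℓ r
  nonTerminating⇒∣ i r nt =
    decidable-stable (2^ i ∣? ℓ r) (λ 2^i∤ℓr → nt (terminating i r 2^i∤ℓr))

  siblings-not-both-nonTerminating : ∀ i r →
    NonTerminating f (suc i) r → ¬ NonTerminating f (suc i) (2 ^ i ℕ.+ r)
  siblings-not-both-nonTerminating i r nt nt′ =
    2^suc∤ (sibling-∥ i r (nonTerminating⇒∣ (suc i) r nt))
           (nonTerminating⇒∣ (suc i) (2 ^ i ℕ.+ r) nt′)

  nonTerminating-child-unique : ∀ {i r r′ s s′} → r ≡ r′ →
    s ≡ r ⊎ s ≡ 2 ^ i ℕ.+ r → s′ ≡ r′ ⊎ s′ ≡ 2 ^ i ℕ.+ r′ →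
    NonTerminating f (suc i) s → NonTerminating f (suc i) s′ → s ≡ s′
  nonTerminating-child-unique refl (inj₁ refl) (inj₁ refl) _ _ = refl
  nonTerminating-child-unique refl (inj₂ refl) (inj₂ refl) _ _ = refl
  nonTerminating-child-unique {i} {r} refl (inj₁ refl) (inj₂ refl) nt nt′ =
    ⊥-elim (siblings-not-both-nonTerminating i r nt nt′)
  nonTerminating-child-unique {i} {r} refl (inj₂ refl) (inj₁ refl) nt nt′ =
    ⊥-elim (siblings-not-both-nonTerminating i r nt′ nt)

  branch : ℕ → ℕ
  branch zero = 0
  branch (suc i) with 2^ suc i ∣? ℓ (branch i)
  ... | yes _ = branch i
  ... | no _ = 2 ^ i ℕ.+ branch i

  branch-spec : ∀ i → branch i < 2 ^ i × 2^ i ∣ ℓ (branch i)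
  branch-spec zero =
    s≤s z≤n , subst (_∣ ℓ 0) (sym 2^-zero) (divides (ℓ 0) (sym (ℤ.*-identityʳ (ℓ 0))))
  branch-spec (suc i) with 2^ suc i ∣? ℓ (branch i) | branch-spec i
  ... | yes 2^si∣ | b<2^i , _ = ℕ.<-≤-trans b<2^i (ℕ.m≤m+n (2 ^ i) _) , 2^si∣
  ... | no 2^si∤ | b<2^i , 2^i∣ =
    ℕ.+-monoʳ-< (2 ^ i) (ℕ.<-≤-trans b<2^i (ℕ.m≤m+n (2 ^ i) 0)) ,
    sibling-∣ i (branch i) 2^i∣ 2^si∤

  branch-child : ∀ i → branch (suc i) ≡ branch i ⊎ branch (suc i) ≡ 2 ^ i ℕ.+ branch i
  branch-child i with 2^ suc i ∣? ℓ (branch i)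
  ... | yes _ = inj₁ refl
  ... | no _ = inj₂ refl

  branch-isInfinite : IsInfiniteBranch f branch
  branch-isInfinite =
    (λ i → proj₁ (branch-spec i)) ,
    branch-child ,
    (λ i → nonTerminating i (branch i) (proj₂ (branch-spec i)))

  infiniteBranch-unique : ∀ r r′ → IsInfiniteBranch f r → IsInfiniteBranch f r′ →
    ∀ i → r i ≡ r′ i
  infiniteBranch-unique r r′ (r< , _) (r′< , _) zero =
    trans (ℕ.n<1⇒n≡0 (r< 0)) (sym (ℕ.n<1⇒n≡0 (r′< 0)))
  infiniteBranch-unique r r′ R@(_ , child , nt) R′@(_ , child′ , nt′) (suc i) =
    nonTerminating-child-unique {i} (infiniteBranch-unique r r′ R R′ i)
      (child i) (child′ i) (nt (suc i)) (nt′ (suc i))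

  uniqueInfiniteBranch : HasUniqueInfiniteBranch f
  uniqueInfiniteBranch = (branch , branch-isInfinite) , infiniteBranch-unique

zero-discriminant⇒a*quad≡square : ∀ a b′ c →
  (b′ * + 2) * (b′ * + 2) - + 4 * a * c ≡ 0ℤ →
  ∀ n → a * quad a (b′ * + 2) c n ≡ (a * + n + b′) * (a * + n + b′)
zero-discriminant⇒a*quad≡square a b′ c disc≡0 n =
  ℤ.i-j≡0⇒i≡j _ _ (ℤ.*-cancelˡ-≡ (+ 4) _ 0ℤ (trans (expand a b′ c (+ n)) (cong -_ disc≡0)))
  where
  expand : ∀ a b′ c n →
    + 4 * (a * (a * n * n + b′ * + 2 * n + c) - (a * n + b′) * (a * n + b′))
      ≡ - ((b′ * + 2) * (b′ * + 2) - + 4 * a * c)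
  expand = solve-∀

corollary10 : (a b c : ℤ) → ¬ (+ 2 ∣ᵤ a) → + 2 ∣ᵤ b →
    b * b - + 4 * a * c ≡ + 0 →
    HasUniqueInfiniteBranch (quad a b c)
corollary10 a b c 2∤a 2∣b disc≡0 with ∣ᵤ⇒∣ {+ 2} {b} 2∣b
... | divides b′ refl =
  uniqueInfiniteBranch a b′ (quad a (b′ * + 2) c)
    (λ 2∣a → 2∤a (∣⇒∣ᵤ 2∣a))
    (zero-discriminant⇒a*quad≡square a b′ c disc≡0)
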